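{- For every integer $k\ge2$, $\kappa_i(C_{3k}^{(3)})=0$ for $i<2k$, and \[ \kappa_{2k+i}(C_{3k}^{(3)})=\frac{3k}{k+2i}\binom{k+2i}{3i}\quad\text{for }0\le i\le k. \]
   Context: The tight cycle $C_\ell^{(3)}$ ($\ell>3$) is the $3$-graph with vertex set $\{1,\dots,\ell\}$ and edges $\{i,i+1,i+2\}$ ($i=1,\dots,\ell$, addition mod $\ell$). For a $3$-graph $H$, $\kappa_m(H)$ is the number of subsets of $E(H)$ of size $m$ such that, in the subgraph formed by those edges, no vertex has degree exactly one. -}

module Defs where

open import Data.Nat using (ℕ; zero; suc; _+_; NonZero)
open import Data.Nat.DivMod using (_mod_)
import Data.Fin
open import Data.Fin using (Fin; toℕ; _≟_)
open import Data.Fin.Subset using (Subset; inside; outside; ∣_∣)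
open import Data.Vec using (Vec; []; _∷_; lookup)
open import Data.List using (List; []; _∷_; map; _++_; filter; length)
open import Data.Product using (_×_; _,_)
open import Data.Bool using (Bool; true; false; _∨_; _∧_)
open import Relation.Nullary using (¬_; does)
open import Relation.Nullary.Decidable using (_×-dec_; ¬?)
open import Data.Nat.Properties as ℕP using ()
open import Data.Fin.Properties as FP using (all?)

record Graph3 (n : ℕ) : Set where
  field
    numEdges : ℕ
    edge     : Fin numEdges → Fin n × Fin n × Fin n
open Graph3 public

incident : ∀ {n} → Fin n → Fin n × Fin n × Fin n → Bool
incident v (a , b , c) = does (v ≟ a) ∨ does (v ≟ b) ∨ does (v ≟ c)

sumFin : ∀ m → (Fin m → ℕ) → ℕ
sumFin zero    f = 0
sumFin (suc m) f = f Data.Fin.zero + sumFin m (λ j → f (Data.Fin.suc j))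

degree : ∀ {n} (H : Graph3 n) → Subset (numEdges H) → Fin n → ℕ
degree H S v = sumFin (numEdges H) (λ j → ind (lookup S j) (incident v (edge H j)))
  where
  ind : Data.Fin.Subset.Side → Bool → ℕ
  ind inside true = 1
  ind _      _    = 0

allSubsets : ∀ m → List (Subset m)
allSubsets zero    = [] ∷ []
allSubsets (suc m) = map (inside ∷_) (allSubsets m) ++ map (outside ∷_) (allSubsets m)

κ : ℕ → ∀ {n} → Graph3 n → ℕ
κ m {n} H = length (filter good (allSubsets (numEdges H)))
  where
  good : (S : Subset (numEdges H)) → _
  good S = (∣ S ∣ ℕP.≟ m) ×-dec all? (λ v → ¬? (degree H S v ℕP.≟ 1))

tightCycle : (ℓ : ℕ) .{{_ : NonZero ℓ}} → Graph3 ℓ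
tightCycle ℓ = record
  { numEdges = ℓ
  ; edge = λ i → (toℕ i mod ℓ) , ((toℕ i + 1) mod ℓ) , ((toℕ i + 2) mod ℓ)
  }

-- Identify an edge set S of C_n with its indicator word s, edge j = {j, j+1, j+2} giving the
-- letter s_j.  Vertex v lies in edges v, v-1, v-2, so S is counted by κ exactly when no cyclic
-- window of three consecutive letters of s contains a single 1.  Such a word with W ones and
-- Z ≥ 1 zeros is made of isolated zeros separated by at least two ones.  Cutting the cycle in
-- front of its last two letters leaves linear words, whose counts all obey the recurrence
-- T(w+2, z+1) = T(w+1, z+1) + T(w, z) of the number T(w, z) = C(w - z, z) of words in the
-- blocks 1 and 011; this gives T(W, Z) + 2 T(W-2, Z-1) = C(a, Z) + 2 C(a-1, Z-1) cyclic words,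
-- with a = W - Z.  By absorption, a times this is (a + 2Z) C(a, Z), and it vanishes when a < Z.
-- For n = 3k and W = 2k + i one has a = k + 2i and Z = k - i.
module Submission where

open import Defs
open import Data.Nat using (ℕ; zero; suc; _+_; _*_; _∸_; _≤_; _<_; _≡ᵇ_; NonZero; s≤s; s≤s⁻¹; z≤n)
open import Data.Nat.Combinatorics using (_C_; nCk+nC[k+1]≡[n+1]C[k+1]; nC1≡n; nCk≡nC[n∸k])
open import Data.Product using (_×_; _,_)
open import Relation.Binary.PropositionalEquality

import Data.Nat.Properties as ℕ
open import Data.Nat.Properties using (m≤n⇒∃[o]m+o≡n)
open import Algebra.Properties.CommutativeSemigroup ℕ.+-commutativeSemigroup
  using () renaming (interchange to +-interchange)
open import Data.Bool using (Bool; true; false; _∧_; _∨_; not; if_then_else_)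
open import Data.Bool.Properties using (∧-zeroʳ; ∧-identityʳ)
open import Data.Empty using (⊥-elim)
open import Data.Fin using (Fin; zero; suc; toℕ; fromℕ; inject₁; _≟_)
open import Data.Fin.Properties using (all?; toℕ-injective; toℕ-fromℕ; toℕ-fromℕ<; toℕ-inject₁; toℕ<n)
open import Data.Fin.Relation.Unary.Top using (view; ‵fromℕ; ‵inj₁)
open import Data.Fin.Subset using (Subset; inside; outside; ∣_∣)
open import Data.Fin.Subset.Properties using (∣p∣≤n)
open import Data.List using (List; []; _∷_; _++_; map; filter; length)
open import Data.List.Properties using (length-++; filter-++; ++-assoc)
open import Data.Nat.DivMod using (_%_; _mod_; %-distribˡ-+; m%n%n≡m%n; m<n⇒m%n≡m; n%n≡0)
open import Data.Nat.Tactic.RingSolver using (solve-∀)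
open import Data.Vec using (Vec; []; _∷_; _∷ʳ_; lookup; toList)
open import Function.Bundles using (_⇔_; mk⇔)
open import Level using (0ℓ)
open import Relation.Nullary using (does; yes; no)
open import Relation.Nullary.Decidable using (does-⇔; ¬?; dec-false)
open import Relation.Unary using (Pred; Decidable)

bit : Bool → ℕ
bit true  = 1
bit false = 0

-- Counting subsets

countSubsets : ∀ m → (Subset m → Bool) → ℕ
countSubsets zero    p = bit (p [])
countSubsets (suc m) p = countSubsets m (λ t → p (inside ∷ t)) + countSubsets m (λ t → p (outside ∷ t))

length-filter-map : ∀ {A B : Set} {P : Pred B 0ℓ} (P? : Decidable P) (f : A → B) xs →
                    length (filter P? (map f xs)) ≡ length (filter (λ x → P? (f x)) xs)
length-filter-map P? f []       = refl
length-filter-map P? f (x ∷ xs) with does (P? (f x))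
... | true  = cong suc (length-filter-map P? f xs)
... | false = length-filter-map P? f xs

length-filter-allSubsets : ∀ m {P : Pred (Subset m) 0ℓ} (P? : Decidable P) →
                           length (filter P? (allSubsets m)) ≡ countSubsets m (λ S → does (P? S))
length-filter-allSubsets zero P? with does (P? [])
... | true  = refl
... | false = refl
length-filter-allSubsets (suc m) P? = begin
  length (filter P? (map (inside ∷_) Sₘ ++ map (outside ∷_) Sₘ))
    ≡⟨ cong length (filter-++ P? (map (inside ∷_) Sₘ) _) ⟩
  length (filter P? (map (inside ∷_) Sₘ) ++ filter P? (map (outside ∷_) Sₘ))
    ≡⟨ length-++ (filter P? (map (inside ∷_) Sₘ)) ⟩
  length (filter P? (map (inside ∷_) Sₘ)) + length (filter P? (map (outside ∷_) Sₘ))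
    ≡⟨ cong₂ _+_ (length-filter-map P? (inside ∷_) Sₘ) (length-filter-map P? (outside ∷_) Sₘ) ⟩
  length (filter (λ t → P? (inside ∷ t)) Sₘ) + length (filter (λ t → P? (outside ∷ t)) Sₘ)
    ≡⟨ cong₂ _+_ (length-filter-allSubsets m _) (length-filter-allSubsets m _) ⟩
  countSubsets (suc m) (λ S → does (P? S)) ∎
  where
  open ≡-Reasoning
  Sₘ = allSubsets m

countSubsets-cong : ∀ m {p q : Subset m → Bool} → (∀ S → p S ≡ q S) → countSubsets m p ≡ countSubsets m q
countSubsets-cong zero    p≗q = cong bit (p≗q [])
countSubsets-cong (suc m) p≗q =
  cong₂ _+_ (countSubsets-cong m (λ t → p≗q (inside ∷ t))) (countSubsets-cong m (λ t → p≗q (outside ∷ t)))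

countSubsets-none : ∀ m {p : Subset m → Bool} → (∀ S → p S ≡ false) → countSubsets m p ≡ 0
countSubsets-none zero    p≗false = cong bit (p≗false [])
countSubsets-none (suc m) p≗false =
  cong₂ _+_ (countSubsets-none m (λ t → p≗false (inside ∷ t))) (countSubsets-none m (λ t → p≗false (outside ∷ t)))

countSubsets-if : ∀ m b (p q : Subset m → Bool) →
                  countSubsets m (λ S → p S ∧ (b ∧ q S)) ≡ (if b then countSubsets m (λ S → p S ∧ q S) else 0)
countSubsets-if m true  p q = refl
countSubsets-if m false p q = countSubsets-none m (λ S → ∧-zeroʳ (p S))

countSubsets-weight>size : ∀ m w (q : Subset m → Bool) → m < w → countSubsets m (λ S → (∣ S ∣ ≡ᵇ w) ∧ q S) ≡ 0
countSubsets-weight>size m w q m<w =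
  countSubsets-none m (λ S → cong (_∧ q S) (dec-false (∣ S ∣ ℕ.≟ w) (ℕ.<⇒≢ (ℕ.≤-<-trans (∣p∣≤n S) m<w))))

countSubsets-∷ʳ : ∀ m (p : Subset (suc m) → Bool) →
                  countSubsets (suc m) p ≡ countSubsets m (λ t → p (t ∷ʳ inside)) + countSubsets m (λ t → p (t ∷ʳ outside))
countSubsets-∷ʳ zero    p = refl
countSubsets-∷ʳ (suc m) p = begin
  countSubsets (suc m) (λ t → p (inside ∷ t)) + countSubsets (suc m) (λ t → p (outside ∷ t))
    ≡⟨ cong₂ _+_ (countSubsets-∷ʳ m (λ t → p (inside ∷ t))) (countSubsets-∷ʳ m (λ t → p (outside ∷ t))) ⟩
  (a + b) + (c + d)
    ≡⟨ +-interchange a b c d ⟩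
  (a + c) + (b + d) ∎
  where
  open ≡-Reasoning
  a = countSubsets m (λ t → p (inside ∷ (t ∷ʳ inside)))
  b = countSubsets m (λ t → p (inside ∷ (t ∷ʳ outside)))
  c = countSubsets m (λ t → p (outside ∷ (t ∷ʳ inside)))
  d = countSubsets m (λ t → p (outside ∷ (t ∷ʳ outside)))

-- Sums over Fin

sumFin-cong : ∀ m {f g : Fin m → ℕ} → (∀ j → f j ≡ g j) → sumFin m f ≡ sumFin m g
sumFin-cong zero    f≗g = refl
sumFin-cong (suc m) f≗g = cong₂ _+_ (f≗g zero) (sumFin-cong m (λ j → f≗g (suc j)))

sumFin-zero : ∀ m {f : Fin m → ℕ} → (∀ j → f j ≡ 0) → sumFin m f ≡ 0
sumFin-zero zero    f≗0 = refl
sumFin-zero (suc m) f≗0 = cong₂ _+_ (f≗0 zero) (sumFin-zero m (λ j → f≗0 (suc j)))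

sumFin-+ : ∀ m (f g : Fin m → ℕ) → sumFin m (λ j → f j + g j) ≡ sumFin m f + sumFin m g
sumFin-+ zero    f g = refl
sumFin-+ (suc m) f g = trans (cong (f zero + g zero +_) (sumFin-+ m (λ j → f (suc j)) (λ j → g (suc j))))
                             (+-interchange (f zero) (g zero) _ _)

sumFin-indicator : ∀ m (s : Fin m → Bool) p → sumFin m (λ j → bit (s j ∧ does (j ≟ p))) ≡ bit (s p)
sumFin-indicator (suc m) s zero = trans
  (cong₂ _+_ (cong bit (∧-identityʳ (s zero))) (sumFin-zero m (λ j → cong bit (∧-zeroʳ (s (suc j))))))
  (ℕ.+-identityʳ (bit (s zero)))
sumFin-indicator (suc m) s (suc p) =
  cong₂ _+_ (cong bit (∧-zeroʳ (s zero))) (sumFin-indicator m (λ j → s (suc j)) p)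

does-≟-disjoint : ∀ {m} (j p q : Fin m) → p ≢ q → does (j ≟ p) ∧ does (j ≟ q) ≡ false
does-≟-disjoint j p q p≢q with j ≟ p | j ≟ q
... | yes j≡p | yes j≡q = ⊥-elim (p≢q (trans (sym j≡p) j≡q))
... | yes _   | no _    = refl
... | no _    | _       = refl

bit-∧-∨-disjoint : ∀ s a b c → a ∧ b ≡ false → a ∧ c ≡ false → b ∧ c ≡ false →
                   bit (s ∧ (a ∨ b ∨ c)) ≡ bit (s ∧ a) + bit (s ∧ b) + bit (s ∧ c)
bit-∧-∨-disjoint false a     b     c     _  _  _  = refl
bit-∧-∨-disjoint true  true  true  c     () _  _
bit-∧-∨-disjoint true  true  false true  _  () _
bit-∧-∨-disjoint true  true  false false _  _  _  = refl
bit-∧-∨-disjoint true  false true  true  _  _  ()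
bit-∧-∨-disjoint true  false true  false _  _  _  = refl
bit-∧-∨-disjoint true  false false c     _  _  _  = refl

sumFin-three-points : ∀ m (s : Fin m → Bool) (p q r : Fin m) → p ≢ q → p ≢ r → q ≢ r →
  sumFin m (λ j → bit (s j ∧ (does (j ≟ p) ∨ does (j ≟ q) ∨ does (j ≟ r)))) ≡ bit (s p) + bit (s q) + bit (s r)
sumFin-three-points m s p q r p≢q p≢r q≢r = begin
  sumFin m (λ j → bit (s j ∧ (does (j ≟ p) ∨ does (j ≟ q) ∨ does (j ≟ r))))
    ≡⟨ sumFin-cong m (λ j → bit-∧-∨-disjoint (s j) _ _ _
         (does-≟-disjoint j p q p≢q) (does-≟-disjoint j p r p≢r) (does-≟-disjoint j q r q≢r)) ⟩
  sumFin m (λ j → 𝟙[ p ] j + 𝟙[ q ] j + 𝟙[ r ] j)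
    ≡⟨ sumFin-+ m (λ j → 𝟙[ p ] j + 𝟙[ q ] j) 𝟙[ r ] ⟩
  sumFin m (λ j → 𝟙[ p ] j + 𝟙[ q ] j) + sumFin m 𝟙[ r ]
    ≡⟨ cong (_+ sumFin m 𝟙[ r ]) (sumFin-+ m 𝟙[ p ] 𝟙[ q ]) ⟩
  sumFin m 𝟙[ p ] + sumFin m 𝟙[ q ] + sumFin m 𝟙[ r ]
    ≡⟨ cong₂ _+_ (cong₂ _+_ (sumFin-indicator m s p) (sumFin-indicator m s q)) (sumFin-indicator m s r) ⟩
  bit (s p) + bit (s q) + bit (s r) ∎
  where
  open ≡-Reasoning
  𝟙[_] : Fin m → Fin m → ℕ
  𝟙[ p ] j = bit (s j ∧ does (j ≟ p))

-- Degrees in the tight cycle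

singleEdge : ∀ {n} → Fin n × Fin n × Fin n → Graph3 n
singleEdge e = record { numEdges = 1 ; edge = λ _ → e }

-- The 0/1 indicator summed by `degree` is local to its definition; one-edge graphs give a name to it.
degree-singleEdge : ∀ {n} (e : Fin n × Fin n × Fin n) s v → degree (singleEdge e) (s ∷ []) v ≡ bit (s ∧ incident v e)
degree-singleEdge e false v = refl
degree-singleEdge e true  v with incident v e
... | true  = refl
... | false = refl

degree≡sumFin : ∀ {n} (H : Graph3 n) S v →
                degree H S v ≡ sumFin (numEdges H) (λ j → bit (lookup S j ∧ incident v (edge H j)))
degree≡sumFin H S v = sumFin-cong (numEdges H)
  (λ j → trans (sym (ℕ.+-identityʳ _)) (degree-singleEdge (edge H j) (lookup S j) v))

cyclicSuc : ∀ {m} → Fin (suc m) → Fin (suc m)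
cyclicSuc {m} j = (toℕ j + 1) mod suc m

cyclicPred : ∀ {m} → Fin (suc m) → Fin (suc m)
cyclicPred zero    = fromℕ _
cyclicPred (suc i) = inject₁ i

toℕ-mod : ∀ m n .{{_ : NonZero n}} → toℕ (m mod n) ≡ m % n
toℕ-mod m n = toℕ-fromℕ< _

mod-toℕ : ∀ {m} (j : Fin (suc m)) → toℕ j mod suc m ≡ j
mod-toℕ {m} j = toℕ-injective (trans (toℕ-mod (toℕ j) (suc m)) (m<n⇒m%n≡m (toℕ<n j)))

[m%n+1]%n≡[m+1]%n : ∀ m n .{{_ : NonZero n}} → (m % n + 1) % n ≡ (m + 1) % n
[m%n+1]%n≡[m+1]%n m n = begin
  (m % n + 1) % n         ≡⟨ %-distribˡ-+ (m % n) 1 n ⟩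
  (m % n % n + 1 % n) % n ≡⟨ cong (λ x → (x + 1 % n) % n) (m%n%n≡m%n m n) ⟩
  (m % n + 1 % n) % n     ≡⟨ %-distribˡ-+ m 1 n ⟨
  (m + 1) % n             ∎
  where open ≡-Reasoning

mod-+2 : ∀ {m} (j : Fin (suc m)) → (toℕ j + 2) mod suc m ≡ cyclicSuc (cyclicSuc j)
mod-+2 {m} j = toℕ-injective (begin
  toℕ ((toℕ j + 2) mod suc m)             ≡⟨ toℕ-mod (toℕ j + 2) (suc m) ⟩
  (toℕ j + 2) % suc m                     ≡⟨ cong (_% suc m) (ℕ.+-assoc (toℕ j) 1 1) ⟨
  (toℕ j + 1 + 1) % suc m                 ≡⟨ [m%n+1]%n≡[m+1]%n (toℕ j + 1) (suc m) ⟨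
  ((toℕ j + 1) % suc m + 1) % suc m       ≡⟨ cong (λ x → (x + 1) % suc m) (toℕ-mod (toℕ j + 1) (suc m)) ⟨
  (toℕ (cyclicSuc j) + 1) % suc m         ≡⟨ toℕ-mod (toℕ (cyclicSuc j) + 1) (suc m) ⟨
  toℕ (cyclicSuc (cyclicSuc j))           ∎)
  where open ≡-Reasoning

cyclicSuc-fromℕ : ∀ m → cyclicSuc (fromℕ m) ≡ zero
cyclicSuc-fromℕ m = toℕ-injective (begin
  toℕ (cyclicSuc (fromℕ m))   ≡⟨ toℕ-mod (toℕ (fromℕ m) + 1) (suc m) ⟩
  (toℕ (fromℕ m) + 1) % suc m ≡⟨ cong (λ x → (x + 1) % suc m) (toℕ-fromℕ m) ⟩
  (m + 1) % suc m             ≡⟨ cong (_% suc m) (ℕ.+-comm m 1) ⟩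
  suc m % suc m               ≡⟨ n%n≡0 (suc m) ⟩
  0                           ∎)
  where open ≡-Reasoning

cyclicSuc-inject₁ : ∀ {m} (i : Fin m) → cyclicSuc (inject₁ i) ≡ suc i
cyclicSuc-inject₁ {m} i = toℕ-injective (begin
  toℕ (cyclicSuc (inject₁ i))     ≡⟨ toℕ-mod (toℕ (inject₁ i) + 1) (suc m) ⟩
  (toℕ (inject₁ i) + 1) % suc m   ≡⟨ cong (λ x → (x + 1) % suc m) (toℕ-inject₁ i) ⟩
  (toℕ i + 1) % suc m             ≡⟨ cong (_% suc m) (ℕ.+-comm (toℕ i) 1) ⟩
  suc (toℕ i) % suc m             ≡⟨ m<n⇒m%n≡m (s≤s (toℕ<n i)) ⟩
  suc (toℕ i)                     ∎)
  where open ≡-Reasoning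

cyclicPred-cyclicSuc : ∀ {m} (j : Fin (suc m)) → cyclicPred (cyclicSuc j) ≡ j
cyclicPred-cyclicSuc {m} j with view j
... | ‵fromℕ          = cong cyclicPred (cyclicSuc-fromℕ m)
... | ‵inj₁ {i = i} _ = cong cyclicPred (cyclicSuc-inject₁ i)

cyclicSuc-cyclicPred : ∀ {m} (v : Fin (suc m)) → cyclicSuc (cyclicPred v) ≡ v
cyclicSuc-cyclicPred zero    = cyclicSuc-fromℕ _
cyclicSuc-cyclicPred (suc i) = cyclicSuc-inject₁ i

≡f⇔≡g : ∀ {A : Set} {f g : A → A} → (∀ x → g (f x) ≡ x) → (∀ x → f (g x) ≡ x) → ∀ v j → v ≡ f j ⇔ j ≡ g v
≡f⇔≡g {f = f} {g} g∘f f∘g v j = mk⇔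
  (λ v≡fj → trans (sym (g∘f j)) (cong g (sym v≡fj)))
  (λ j≡gv → trans (sym (f∘g v)) (cong f (sym j≡gv)))

incident-tightCycle : ∀ {m} (v j : Fin (suc m)) → incident v (edge (tightCycle (suc m)) j)
                      ≡ (does (j ≟ v) ∨ does (j ≟ cyclicPred v) ∨ does (j ≟ cyclicPred (cyclicPred v)))
incident-tightCycle {m} v j = cong₂ _∨_ (does-⇔ zeroth (v ≟ _) (j ≟ _))
  (cong₂ _∨_ (does-⇔ first (v ≟ _) (j ≟ _))
             (trans (cong (λ u → does (v ≟ u)) (mod-+2 j)) (does-⇔ second (v ≟ _) (j ≟ _))))
  where
  zeroth : v ≡ toℕ j mod suc m ⇔ j ≡ v
  zeroth = ≡f⇔≡g {f = λ i → toℕ i mod suc m} {g = λ i → i} mod-toℕ mod-toℕ v j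
  first : v ≡ cyclicSuc j ⇔ j ≡ cyclicPred v
  first = ≡f⇔≡g {f = cyclicSuc} {g = cyclicPred} cyclicPred-cyclicSuc cyclicSuc-cyclicPred v j
  second : v ≡ cyclicSuc (cyclicSuc j) ⇔ j ≡ cyclicPred (cyclicPred v)
  second = ≡f⇔≡g {f = λ i → cyclicSuc (cyclicSuc i)} {g = λ i → cyclicPred (cyclicPred i)}
    (λ i → trans (cong cyclicPred (cyclicPred-cyclicSuc (cyclicSuc i))) (cyclicPred-cyclicSuc i))
    (λ i → trans (cong cyclicSuc (cyclicSuc-cyclicPred (cyclicPred i))) (cyclicSuc-cyclicPred i))
    v j

cyclicPred-≢ : ∀ {m} (v : Fin (2 + m)) → v ≢ cyclicPred v
cyclicPred-≢ zero    ()
cyclicPred-≢ (suc i) i+1≡i = ℕ.m≢1+n+m (toℕ i) {0} (sym (trans (cong toℕ i+1≡i) (toℕ-inject₁ i)))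

cyclicPred²-≢ : ∀ {m} (v : Fin (3 + m)) → v ≢ cyclicPred (cyclicPred v)
cyclicPred²-≢ zero          ()
cyclicPred²-≢ (suc zero)    ()
cyclicPred²-≢ (suc (suc i)) i+2≡i =
  ℕ.m≢1+n+m (toℕ i) {1} (sym (trans (cong toℕ i+2≡i) (trans (toℕ-inject₁ (inject₁ i)) (toℕ-inject₁ i))))

degree-tightCycle : ∀ {N} (S : Subset (3 + N)) v → degree (tightCycle (3 + N)) S v
                    ≡ bit (lookup S v) + bit (lookup S (cyclicPred v)) + bit (lookup S (cyclicPred (cyclicPred v)))
degree-tightCycle {N} S v = begin
  degree (tightCycle (3 + N)) S v
    ≡⟨ degree≡sumFin (tightCycle (3 + N)) S v ⟩
  sumFin (3 + N) (λ j → bit (lookup S j ∧ incident v (edge (tightCycle (3 + N)) j)))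
    ≡⟨ sumFin-cong (3 + N) (λ j → cong (λ b → bit (lookup S j ∧ b)) (incident-tightCycle v j)) ⟩
  sumFin (3 + N) (λ j → bit (lookup S j ∧ (does (j ≟ v) ∨ does (j ≟ cyclicPred v) ∨ does (j ≟ cyclicPred (cyclicPred v)))))
    ≡⟨ sumFin-three-points (3 + N) (lookup S) v (cyclicPred v) (cyclicPred (cyclicPred v))
         (cyclicPred-≢ v) (cyclicPred²-≢ v) (cyclicPred-≢ (cyclicPred v)) ⟩
  bit (lookup S v) + bit (lookup S (cyclicPred v)) + bit (lookup S (cyclicPred (cyclicPred v))) ∎
  where open ≡-Reasoning

-- Admissible words

admissible : Bool → Bool → Bool → Bool
admissible a b c = not (bit a + bit b + bit c ≡ᵇ 1)

windowsAdmissible : Bool → Bool → List Bool → Bool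
windowsAdmissible x y []       = true
windowsAdmissible x y (z ∷ ws) = admissible x y z ∧ windowsAdmissible y z ws

-- The windows are read cyclically, starting with the one that ends at position 0.
cyclicallyAdmissible : ∀ {n} → Vec Bool n → Bool
cyclicallyAdmissible {zero}  S = true
cyclicallyAdmissible {suc m} S =
  windowsAdmissible (lookup S (cyclicPred (cyclicPred zero))) (lookup S (cyclicPred zero)) (toList S)

cyclicCount : ℕ → ℕ → ℕ
cyclicCount n W = countSubsets n (λ S → (∣ S ∣ ≡ᵇ W) ∧ cyclicallyAdmissible S)

all?-windowsAdmissible : ∀ {m} x y (w : Vec Bool m) {P : Pred (Fin m) 0ℓ} (P? : Decidable P) →
  (∀ v → does (P? v) ≡ admissible (lookup (x ∷ y ∷ w) (inject₁ (inject₁ v))) (lookup (y ∷ w) (inject₁ v)) (lookup w v)) →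
  does (all? P?) ≡ windowsAdmissible x y (toList w)
all?-windowsAdmissible x y []      P? P≗ = refl
all?-windowsAdmissible x y (z ∷ w) P? P≗ =
  cong₂ _∧_ (P≗ zero) (all?-windowsAdmissible y z w (λ v → P? (suc v)) (λ v → P≗ (suc v)))

lookup-cyclicPred : ∀ {A : Set} {m} (S : Vec A (suc m)) v →
                    lookup S (cyclicPred v) ≡ lookup (lookup S (cyclicPred zero) ∷ S) (inject₁ v)
lookup-cyclicPred S zero    = refl
lookup-cyclicPred S (suc v) = refl

lookup-cyclicPred² : ∀ {A : Set} {m} (S : Vec A (2 + m)) v → lookup S (cyclicPred (cyclicPred v))
                     ≡ lookup (lookup S (cyclicPred (cyclicPred zero)) ∷ lookup S (cyclicPred zero) ∷ S) (inject₁ (inject₁ v))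
lookup-cyclicPred² S zero          = refl
lookup-cyclicPred² S (suc zero)    = refl
lookup-cyclicPred² S (suc (suc v)) = refl

noDegreeOne≡cyclicallyAdmissible : ∀ {N} (S : Subset (3 + N)) →
  does (all? (λ v → ¬? (degree (tightCycle (3 + N)) S v ℕ.≟ 1))) ≡ cyclicallyAdmissible S
noDegreeOne≡cyclicallyAdmissible {N} S = all?-windowsAdmissible x y S (λ v → ¬? (degree H S v ℕ.≟ 1)) vertex
  where
  H = tightCycle (3 + N)
  x = lookup S (cyclicPred (cyclicPred zero))
  y = lookup S (cyclicPred zero)
  reverse : ∀ a b c → a + b + c ≡ c + b + a
  reverse = solve-∀
  vertex : ∀ v → not (degree H S v ≡ᵇ 1)
                 ≡ admissible (lookup (x ∷ y ∷ S) (inject₁ (inject₁ v))) (lookup (y ∷ S) (inject₁ v)) (lookup S v)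
  vertex v = cong (λ d → not (d ≡ᵇ 1)) (begin
    degree H S v
      ≡⟨ degree-tightCycle S v ⟩
    bit (lookup S v) + bit (lookup S (cyclicPred v)) + bit (lookup S (cyclicPred (cyclicPred v)))
      ≡⟨ reverse (bit (lookup S v)) _ _ ⟩
    bit (lookup S (cyclicPred (cyclicPred v))) + bit (lookup S (cyclicPred v)) + bit (lookup S v)
      ≡⟨ cong₂ (λ a b → bit a + bit b + bit (lookup S v)) (lookup-cyclicPred² S v) (lookup-cyclicPred S v) ⟩
    bit (lookup (x ∷ y ∷ S) (inject₁ (inject₁ v))) + bit (lookup (y ∷ S) (inject₁ v)) + bit (lookup S v) ∎)
    where open ≡-Reasoning

κ-tightCycle : ∀ n .{{_ : NonZero n}} W → 3 ≤ n → κ W (tightCycle n) ≡ cyclicCount n W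
κ-tightCycle (suc (suc (suc N))) W (s≤s (s≤s (s≤s _))) = trans (length-filter-allSubsets (3 + N) _)
  (countSubsets-cong (3 + N) (λ S → cong ((∣ S ∣ ≡ᵇ W) ∧_) (noDegreeOne≡cyclicallyAdmissible S)))

-- Linear counts and block words

accepts : Bool → Bool → List Bool → ∀ {m} → Subset m → Bool
accepts x y e t = windowsAdmissible x y (toList t ++ e)

linearCount : Bool → Bool → List Bool → ℕ → ℕ → ℕ
linearCount x y e w z = countSubsets (w + z) (λ t → (∣ t ∣ ≡ᵇ w) ∧ accepts x y e t)

linearCount-+-suc : ∀ x y e w z →
  countSubsets (w + suc z) (λ t → (∣ t ∣ ≡ᵇ suc w) ∧ accepts x y e t) ≡ linearCount x y e (suc w) z
linearCount-+-suc x y e w z = cong (λ m → countSubsets m (λ t → (∣ t ∣ ≡ᵇ suc w) ∧ accepts x y e t)) (ℕ.+-suc w z)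

linearCount-suc-suc : ∀ x y e w z → linearCount x y e (suc w) (suc z)
  ≡ (if admissible x y true then linearCount y true e w (suc z) else 0)
  + (if admissible x y false then linearCount y false e (suc w) z else 0)
linearCount-suc-suc x y e w z = cong₂ _+_
  (countSubsets-if (w + suc z) (admissible x y true) (λ t → ∣ t ∣ ≡ᵇ w) (accepts y true e))
  (trans (countSubsets-if (w + suc z) (admissible x y false) (λ t → ∣ t ∣ ≡ᵇ suc w) (accepts y false e))
         (cong (if admissible x y false then_else 0) (linearCount-+-suc y false e w z)))

linearCount-suc-zero : ∀ x y e w →
  linearCount x y e (suc w) 0 ≡ (if admissible x y true then linearCount y true e w 0 else 0)
linearCount-suc-zero x y e w = trans
  (cong₂ _+_ (countSubsets-if (w + 0) (admissible x y true) (λ t → ∣ t ∣ ≡ᵇ w) (accepts y true e))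
             (countSubsets-weight>size (w + 0) (suc w) (λ t → admissible x y false ∧ accepts y false e t)
                                     (s≤s (ℕ.≤-reflexive (ℕ.+-identityʳ w)))))
  (ℕ.+-identityʳ _)

linearCount-zero-suc : ∀ x y e z →
  linearCount x y e 0 (suc z) ≡ (if admissible x y false then linearCount y false e 0 z else 0)
linearCount-zero-suc x y e z = cong₂ _+_
  (countSubsets-none z (λ _ → refl))
  (countSubsets-if z (admissible x y false) (λ t → ∣ t ∣ ≡ᵇ 0) (accepts y false e))

linearCount-10 : ∀ e w z → linearCount true false e (suc w) z ≡ linearCount false true e w z
linearCount-10 e w zero    = linearCount-suc-zero true false e w
linearCount-10 e w (suc z) = trans (linearCount-suc-suc true false e w z) (ℕ.+-identityʳ _)

linearCount-01 : ∀ e w z → linearCount false true e (suc w) z ≡ linearCount true true e w z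
linearCount-01 e w zero    = linearCount-suc-zero false true e w
linearCount-01 e w (suc z) = trans (linearCount-suc-suc false true e w z) (ℕ.+-identityʳ _)

linearCount-10-noOnes : ∀ e z → linearCount true false e 0 (suc z) ≡ 0
linearCount-10-noOnes e z = linearCount-zero-suc true false e z

linearCount-01-noOnes : ∀ e z → linearCount false true e 0 (suc z) ≡ 0
linearCount-01-noOnes e z = linearCount-zero-suc false true e z

countSubsets-ones-after-00 : ∀ m e w → countSubsets m (λ t → (∣ t ∣ ≡ᵇ suc w) ∧ accepts false false e t) ≡ 0
countSubsets-ones-after-00 zero    e w = refl
countSubsets-ones-after-00 (suc m) e w =
  cong₂ _+_ (countSubsets-none m (λ t → ∧-zeroʳ (∣ t ∣ ≡ᵇ w))) (countSubsets-ones-after-00 m e w)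

TokenRecurrence : (ℕ → ℕ → ℕ) → Set
TokenRecurrence f = ∀ w z → f (2 + w) (suc z) ≡ f (suc w) (suc z) + f w z

TokenRecurrence-unique : ∀ {f g : ℕ → ℕ → ℕ} → TokenRecurrence f → TokenRecurrence g →
  (∀ w → f w 0 ≡ g w 0) → (∀ z → f 0 (suc z) ≡ g 0 (suc z)) → (∀ z → f 1 (suc z) ≡ g 1 (suc z)) →
  ∀ w z → f w z ≡ g w z
TokenRecurrence-unique {f} {g} rf rg f≡g₀ f≡g⁰ f≡g¹ = go
  where
  go : ∀ w z → f w z ≡ g w z
  go w             zero    = f≡g₀ w
  go zero          (suc z) = f≡g⁰ z
  go (suc zero)    (suc z) = f≡g¹ z
  go (suc (suc w)) (suc z) = trans (rf w z) (trans (cong₂ _+_ (go (suc w) (suc z)) (go w z)) (sym (rg w z)))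

-- The number of words in the blocks 1 and 011 with w ones and z zeros, split by the last block.
tokens : ℕ → ℕ → ℕ
tokens w             zero    = 1
tokens zero          (suc z) = 0
tokens (suc zero)    (suc z) = 0
tokens (suc (suc w)) (suc z) = tokens (suc w) (suc z) + tokens w z

linearCount-11-recurrence : ∀ e → TokenRecurrence (linearCount true true e)
linearCount-11-recurrence e w z = trans (linearCount-suc-suc true true e (suc w) z)
  (cong (linearCount true true e (suc w) (suc z) +_) (trans (linearCount-10 e (suc w) z) (linearCount-01 e w z)))

linearCount-11-unique : ∀ e {g : ℕ → ℕ → ℕ} → TokenRecurrence g →
  (∀ w → g w 0 ≡ bit (windowsAdmissible true true e)) →
  g 0 1 ≡ linearCount true false e 0 0 → g 1 1 ≡ linearCount true false e 0 0 + linearCount false true e 0 0 →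
  (∀ z → g 0 (2 + z) ≡ 0) → (∀ z → g 1 (2 + z) ≡ 0) →
  ∀ w z → linearCount true true e w z ≡ g w z
linearCount-11-unique e {g} rg g₀ g01 g11 g0 g1 =
  TokenRecurrence-unique (linearCount-11-recurrence e) rg (λ w → trans (noZeros w) (sym (g₀ w))) noOnes oneOne
  where
  noZeros : ∀ w → linearCount true true e w 0 ≡ bit (windowsAdmissible true true e)
  noZeros zero    = refl
  noZeros (suc w) = trans (linearCount-suc-zero true true e w) (noZeros w)
  noOnes₂ : ∀ z → linearCount true true e 0 (2 + z) ≡ 0
  noOnes₂ z = trans (linearCount-zero-suc true true e (suc z)) (linearCount-10-noOnes e z)
  noOnes : ∀ z → linearCount true true e 0 (suc z) ≡ g 0 (suc z)
  noOnes zero    = trans (linearCount-zero-suc true true e 0) (sym g01)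
  noOnes (suc z) = trans (noOnes₂ z) (sym (g0 z))
  oneOne : ∀ z → linearCount true true e 1 (suc z) ≡ g 1 (suc z)
  oneOne zero    = trans (linearCount-suc-suc true true e 0 0)
    (trans (cong₂ _+_ (linearCount-zero-suc true true e 0) (linearCount-10 e 0 0)) (sym g11))
  oneOne (suc z) = trans (linearCount-suc-suc true true e 0 (suc z))
    (trans (cong₂ _+_ (noOnes₂ z) (trans (linearCount-10 e 0 (suc z)) (linearCount-01-noOnes e z))) (sym (g1 z)))

-- After 11 the admissible words are the block words followed by nothing, by 0 or by 01; the
-- suffixes 11, 10 and 01 turn them into block words with two, one or no additional ones.
linearCount-11-11 : ∀ w z → linearCount true true (true ∷ true ∷ []) w z ≡ tokens (2 + w) z
linearCount-11-11 = linearCount-11-unique _ (λ _ _ → refl) (λ _ → refl) refl refl (λ _ → refl) (λ _ → refl)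

linearCount-11-10 : ∀ w z → linearCount true true (true ∷ false ∷ []) w z ≡ tokens (1 + w) z
linearCount-11-10 = linearCount-11-unique _ (λ _ _ → refl) (λ _ → refl) refl refl (λ _ → refl) (λ _ → refl)

linearCount-11-01 : ∀ w z → linearCount true true (false ∷ true ∷ []) w z ≡ tokens w z
linearCount-11-01 = linearCount-11-unique _ (λ _ _ → refl) (λ _ → refl) refl refl (λ _ → refl) (λ _ → refl)

linearCount-01-10 : ∀ w z → linearCount false true (true ∷ false ∷ []) w z ≡ tokens w z
linearCount-01-10 zero    zero    = refl
linearCount-01-10 zero    (suc z) = linearCount-01-noOnes (true ∷ false ∷ []) z
linearCount-01-10 (suc w) z       = trans (linearCount-01 (true ∷ false ∷ []) w z) (linearCount-11-10 w z)

-- Cyclic counts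

lookup-∷ʳ-fromℕ : ∀ {A : Set} {m} (t : Vec A m) x → lookup (t ∷ʳ x) (fromℕ m) ≡ x
lookup-∷ʳ-fromℕ []      x = refl
lookup-∷ʳ-fromℕ (a ∷ t) x = lookup-∷ʳ-fromℕ t x

lookup-∷ʳ-inject₁ : ∀ {A : Set} {m} (t : Vec A m) x i → lookup (t ∷ʳ x) (inject₁ i) ≡ lookup t i
lookup-∷ʳ-inject₁ (a ∷ t) x zero    = refl
lookup-∷ʳ-inject₁ (a ∷ t) x (suc i) = lookup-∷ʳ-inject₁ t x i

toList-∷ʳ : ∀ {A : Set} {m} (t : Vec A m) x → toList (t ∷ʳ x) ≡ toList t ++ x ∷ []
toList-∷ʳ []      x = refl
toList-∷ʳ (a ∷ t) x = cong (a ∷_) (toList-∷ʳ t x)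

∣∷ʳ∣ : ∀ {m} (t : Subset m) x → ∣ t ∷ʳ x ∣ ≡ bit x + ∣ t ∣
∣∷ʳ∣ []          true  = refl
∣∷ʳ∣ []          false = refl
∣∷ʳ∣ (true ∷ t)  x     = trans (cong suc (∣∷ʳ∣ t x)) (sym (ℕ.+-suc (bit x) ∣ t ∣))
∣∷ʳ∣ (false ∷ t) x     = ∣∷ʳ∣ t x

cyclicallyAdmissible-∷ʳ : ∀ {m} (t : Vec Bool m) x y →
                          cyclicallyAdmissible ((t ∷ʳ x) ∷ʳ y) ≡ accepts x y (x ∷ y ∷ []) t
cyclicallyAdmissible-∷ʳ {m} t x y = trans
  (cong₂ (λ a b → windowsAdmissible a b (toList ((t ∷ʳ x) ∷ʳ y)))
         (trans (lookup-∷ʳ-inject₁ (t ∷ʳ x) y (fromℕ m)) (lookup-∷ʳ-fromℕ t x))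
         (lookup-∷ʳ-fromℕ (t ∷ʳ x) y))
  (cong (windowsAdmissible x y) (begin
    toList ((t ∷ʳ x) ∷ʳ y)         ≡⟨ toList-∷ʳ (t ∷ʳ x) y ⟩
    toList (t ∷ʳ x) ++ y ∷ []      ≡⟨ cong (_++ y ∷ []) (toList-∷ʳ t x) ⟩
    (toList t ++ x ∷ []) ++ y ∷ [] ≡⟨ ++-assoc (toList t) (x ∷ []) (y ∷ []) ⟩
    toList t ++ x ∷ y ∷ []         ∎))
  where open ≡-Reasoning

cyclicCountEnding : Bool → Bool → ℕ → ℕ → ℕ
cyclicCountEnding x y m W = countSubsets m (λ t → (bit y + (bit x + ∣ t ∣) ≡ᵇ W) ∧ accepts x y (x ∷ y ∷ []) t)

cyclicCount-∷ʳ : ∀ m W → cyclicCount (2 + m) W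
  ≡ (cyclicCountEnding true true m W + cyclicCountEnding false true m W)
  + (cyclicCountEnding true false m W + cyclicCountEnding false false m W)
cyclicCount-∷ʳ m W = begin
  cyclicCount (2 + m) W
    ≡⟨ countSubsets-∷ʳ (suc m) p ⟩
  countSubsets (suc m) (λ u → p (u ∷ʳ true)) + countSubsets (suc m) (λ u → p (u ∷ʳ false))
    ≡⟨ cong₂ _+_ (countSubsets-∷ʳ m (λ u → p (u ∷ʳ true))) (countSubsets-∷ʳ m (λ u → p (u ∷ʳ false))) ⟩
  (countSubsets m (pₓᵧ true true) + countSubsets m (pₓᵧ false true))
  + (countSubsets m (pₓᵧ true false) + countSubsets m (pₓᵧ false false))
    ≡⟨ cong₂ _+_ (cong₂ _+_ (ending true true) (ending false true))
                 (cong₂ _+_ (ending true false) (ending false false)) ⟩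
  (cyclicCountEnding true true m W + cyclicCountEnding false true m W)
  + (cyclicCountEnding true false m W + cyclicCountEnding false false m W) ∎
  where
  open ≡-Reasoning
  p : Subset (2 + m) → Bool
  p S = (∣ S ∣ ≡ᵇ W) ∧ cyclicallyAdmissible S
  pₓᵧ : Bool → Bool → Subset m → Bool
  pₓᵧ x y t = p ((t ∷ʳ x) ∷ʳ y)
  ending : ∀ x y → countSubsets m (pₓᵧ x y) ≡ cyclicCountEnding x y m W
  ending x y = countSubsets-cong m (λ t → cong₂ _∧_
    (cong (_≡ᵇ W) (trans (∣∷ʳ∣ (t ∷ʳ x) y) (cong (bit y +_) (∣∷ʳ∣ t x))))
    (cyclicallyAdmissible-∷ʳ t x y))

cyclicCount-singleOne : ∀ m → cyclicCount (2 + m) 1 ≡ 0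
cyclicCount-singleOne m = trans (cyclicCount-∷ʳ m 1)
  (cong₂ _+_ (cong₂ _+_ (countSubsets-none m (λ _ → refl)) (ending01 m))
             (cong₂ _+_ (ending10 m) (countSubsets-ones-after-00 m (false ∷ false ∷ []) 0)))
  where
  ending01 : ∀ m → linearCount false true (false ∷ true ∷ []) 0 m ≡ 0
  ending01 zero    = refl
  ending01 (suc m) = linearCount-01-noOnes (false ∷ true ∷ []) m
  ending10 : ∀ m → linearCount true false (true ∷ false ∷ []) 0 m ≡ 0
  ending10 zero    = refl
  ending10 (suc m) = linearCount-10-noOnes (true ∷ false ∷ []) m

cyclicCount-noZeros : ∀ V → cyclicCount (2 + (V + 0)) (2 + V) ≡ 1
cyclicCount-noZeros V = trans (cyclicCount-∷ʳ (V + 0) (2 + V))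
  (cong₂ _+_ (cong₂ _+_ (linearCount-11-11 V 0) (tooMany false true))
             (cong₂ _+_ (tooMany true false) (countSubsets-ones-after-00 (V + 0) (false ∷ false ∷ []) (suc V))))
  where
  tooMany : ∀ x y → countSubsets (V + 0) (λ t → (∣ t ∣ ≡ᵇ suc V) ∧ accepts x y (x ∷ y ∷ []) t) ≡ 0
  tooMany x y = countSubsets-weight>size (V + 0) (suc V) (accepts x y (x ∷ y ∷ []))
                                       (s≤s (ℕ.≤-reflexive (ℕ.+-identityʳ V)))

cyclicCount-tokens : ∀ V z → cyclicCount (2 + (V + suc z)) (2 + V) ≡ tokens (2 + V) (suc z) + 2 * tokens V z
cyclicCount-tokens V z = begin
  cyclicCount (2 + (V + suc z)) (2 + V)
    ≡⟨ cyclicCount-∷ʳ (V + suc z) (2 + V) ⟩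
  (linearCount true true e₁₁ V (suc z) + cyclicCountEnding false true (V + suc z) (2 + V))
  + (cyclicCountEnding true false (V + suc z) (2 + V) + cyclicCountEnding false false (V + suc z) (2 + V))
    ≡⟨ cong₂ _+_ (cong₂ _+_ (linearCount-11-11 V (suc z)) ending01)
                 (cong₂ _+_ ending10 (countSubsets-ones-after-00 (V + suc z) e₀₀ (suc V))) ⟩
  (tokens (2 + V) (suc z) + tokens V z) + (tokens V z + 0)
    ≡⟨ regroup (tokens (2 + V) (suc z)) (tokens V z) ⟩
  tokens (2 + V) (suc z) + 2 * tokens V z ∎
  where
  open ≡-Reasoning
  regroup : ∀ a b → (a + b) + (b + 0) ≡ a + 2 * b
  regroup = solve-∀
  e₁₁ e₁₀ e₀₁ e₀₀ : List Bool
  e₁₁ = true ∷ true ∷ []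
  e₁₀ = true ∷ false ∷ []
  e₀₁ = false ∷ true ∷ []
  e₀₀ = false ∷ false ∷ []
  ending01 : cyclicCountEnding false true (V + suc z) (2 + V) ≡ tokens V z
  ending01 = trans (linearCount-+-suc false true e₀₁ V z) (trans (linearCount-01 e₀₁ V z) (linearCount-11-01 V z))
  ending10 : cyclicCountEnding true false (V + suc z) (2 + V) ≡ tokens V z
  ending10 = trans (linearCount-+-suc true false e₁₀ V z) (trans (linearCount-10 e₁₀ V z) (linearCount-01-10 V z))

-- Binomial coefficients

tokens-vanish : ∀ w z → w < z + z → tokens w z ≡ 0
tokens-vanish zero          (suc z) _ = refl
tokens-vanish (suc zero)    (suc z) _ = refl
tokens-vanish (suc (suc w)) (suc z) (s≤s w+2<z+z+1) = cong₂ _+_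
  (tokens-vanish (suc w) (suc z) (ℕ.m<n⇒m<1+n w+2<z+z+1))
  (tokens-vanish w z (s≤s⁻¹ (subst (suc (suc w) ≤_) (ℕ.+-suc z z) w+2<z+z+1)))

tokens-binomial : ∀ a z → tokens (a + z) z ≡ a C z
tokens-binomial a       zero    = refl
tokens-binomial zero    (suc z) = tokens-vanish (suc z) (suc z) (s≤s (ℕ.m≤n+m (suc z) z))
tokens-binomial (suc a) (suc z) = begin
  tokens (suc (a + suc z)) (suc z)                ≡⟨ cong (λ w → tokens (suc w) (suc z)) (ℕ.+-suc a z) ⟩
  tokens (suc (a + z)) (suc z) + tokens (a + z) z ≡⟨ cong (λ w → tokens w (suc z) + tokens (a + z) z) (ℕ.+-suc a z) ⟨
  tokens (a + suc z) (suc z) + tokens (a + z) z   ≡⟨ cong₂ _+_ (tokens-binomial a (suc z)) (tokens-binomial a z) ⟩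
  a C suc z + a C z                               ≡⟨ ℕ.+-comm (a C suc z) (a C z) ⟩
  a C z + a C suc z                               ≡⟨ nCk+nC[k+1]≡[n+1]C[k+1] a z ⟩
  suc a C suc z                                   ∎
  where open ≡-Reasoning

[k+1]*[n+1]C[k+1]≡[n+1]*nCk : ∀ n k → suc k * (suc n C suc k) ≡ suc n * (n C k)
[k+1]*[n+1]C[k+1]≡[n+1]*nCk zero    zero    = refl
[k+1]*[n+1]C[k+1]≡[n+1]*nCk zero    (suc k) = ℕ.*-zeroʳ (2 + k)
[k+1]*[n+1]C[k+1]≡[n+1]*nCk (suc n) zero    =
  trans (ℕ.*-identityˡ ((2 + n) C 1)) (trans (nC1≡n (2 + n)) (sym (ℕ.*-identityʳ (2 + n))))
[k+1]*[n+1]C[k+1]≡[n+1]*nCk (suc n) (suc k) = begin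
  (2 + k) * ((2 + n) C (2 + k))
    ≡⟨ cong ((2 + k) *_) (nCk+nC[k+1]≡[n+1]C[k+1] (suc n) (suc k)) ⟨
  (2 + k) * (X + Y)
    ≡⟨ split k X Y ⟩
  X + (suc k * X + (2 + k) * Y)
    ≡⟨ cong (X +_) (cong₂ _+_ ([k+1]*[n+1]C[k+1]≡[n+1]*nCk n k) ([k+1]*[n+1]C[k+1]≡[n+1]*nCk n (suc k))) ⟩
  X + (suc n * (n C k) + suc n * (n C suc k))
    ≡⟨ cong (X +_) (ℕ.*-distribˡ-+ (suc n) (n C k) (n C suc k)) ⟨
  X + suc n * (n C k + n C suc k)
    ≡⟨ cong (λ c → X + suc n * c) (nCk+nC[k+1]≡[n+1]C[k+1] n k) ⟩
  X + suc n * X ∎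
  where
  open ≡-Reasoning
  X = suc n C suc k
  Y = suc n C (2 + k)
  split : ∀ k x y → (2 + k) * (x + y) ≡ x + (suc k * x + (2 + k) * y)
  split = solve-∀

-- Closed forms

cyclicCount-vanish : ∀ W Z → 1 ≤ W → W < 2 * Z → cyclicCount (W + Z) W ≡ 0
cyclicCount-vanish 1             (suc Z) _ _    = cyclicCount-singleOne Z
cyclicCount-vanish (suc (suc V)) (suc z) _ W<2Z = begin
  cyclicCount (2 + V + suc z) (2 + V)     ≡⟨ cyclicCount-tokens V z ⟩
  tokens (2 + V) (suc z) + 2 * tokens V z ≡⟨ cong₂ (λ a b → a + 2 * b) (tokens-vanish (2 + V) (suc z) W<Z+Z)
                                                                    (tokens-vanish V z V<z+z) ⟩
  0                                       ∎
  where
  open ≡-Reasoning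
  W<Z+Z : 2 + V < suc z + suc z
  W<Z+Z = subst (2 + V <_) (cong (suc z +_) (ℕ.+-identityʳ (suc z))) W<2Z
  V<z+z : V < z + z
  V<z+z = s≤s⁻¹ (subst (2 + V ≤_) (ℕ.+-suc z z) (s≤s⁻¹ W<Z+Z))

cyclicCount-closed : ∀ a Z → a * cyclicCount (a + 2 * Z) (a + Z) ≡ (a + 2 * Z) * (a C Z)
cyclicCount-closed zero          zero          = refl
cyclicCount-closed zero          (suc z)       = sym (ℕ.*-zeroʳ (2 * suc z))
cyclicCount-closed 1             zero          = refl
cyclicCount-closed 1             1             = refl
cyclicCount-closed 1             (suc (suc z)) = begin
  1 * cyclicCount (1 + 2 * (2 + z)) (3 + z) ≡⟨ ℕ.*-identityˡ _ ⟩
  cyclicCount (1 + 2 * (2 + z)) (3 + z)     ≡⟨ cong (λ n → cyclicCount n (3 + z)) (n≡W+Z z) ⟩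
  cyclicCount (3 + z + (2 + z)) (3 + z)     ≡⟨ cyclicCount-vanish (3 + z) (2 + z) (s≤s z≤n)
                                                 (subst (4 + z ≤_) (sym (2Z≡4+z+z z)) (ℕ.m≤m+n (4 + z) z)) ⟩
  0                                         ≡⟨ ℕ.*-zeroʳ (1 + 2 * (2 + z)) ⟨
  (1 + 2 * (2 + z)) * 0                     ∎
  where
  open ≡-Reasoning
  n≡W+Z : ∀ z → 1 + 2 * (2 + z) ≡ 3 + z + (2 + z)
  n≡W+Z = solve-∀
  2Z≡4+z+z : ∀ z → 2 * (2 + z) ≡ 4 + z + z
  2Z≡4+z+z = solve-∀
cyclicCount-closed (suc (suc A)) zero          = begin
  (2 + A) * cyclicCount (2 + A + 0) (2 + A + 0) ≡⟨ cong (λ W → (2 + A) * cyclicCount (2 + A + 0) W)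
                                                        (ℕ.+-identityʳ (2 + A)) ⟩
  (2 + A) * cyclicCount (2 + A + 0) (2 + A)     ≡⟨ cong ((2 + A) *_) (cyclicCount-noZeros A) ⟩
  (2 + A) * 1                                   ≡⟨ cong (_* 1) (ℕ.+-identityʳ (2 + A)) ⟨
  (2 + A + 0) * 1                               ∎
  where open ≡-Reasoning
cyclicCount-closed (suc (suc A)) (suc z)       = begin
  a * cyclicCount (a + 2 * Z) (a + Z)
    ≡⟨ cong (λ n → a * cyclicCount n (a + Z)) (rearrange A z) ⟩
  a * cyclicCount (2 + (A + Z + Z)) (a + Z)
    ≡⟨ cong (a *_) (cyclicCount-tokens (A + Z) z) ⟩
  a * (tokens (a + Z) Z + 2 * tokens (A + Z) z)
    ≡⟨ cong (λ t → a * (tokens (a + Z) Z + 2 * tokens t z)) (ℕ.+-suc A z) ⟩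
  a * (tokens (a + Z) Z + 2 * tokens (suc A + z) z)
    ≡⟨ cong₂ (λ x y → a * (x + 2 * y)) (tokens-binomial a Z) (tokens-binomial (suc A) z) ⟩
  a * (a C Z + 2 * (suc A C z))
    ≡⟨ distribute a (a C Z) (suc A C z) ⟩
  a * (a C Z) + 2 * (a * (suc A C z))
    ≡⟨ cong (λ y → a * (a C Z) + 2 * y) ([k+1]*[n+1]C[k+1]≡[n+1]*nCk (suc A) z) ⟨
  a * (a C Z) + 2 * (Z * (a C Z))
    ≡⟨ collect a Z (a C Z) ⟩
  (a + 2 * Z) * (a C Z) ∎
  where
  open ≡-Reasoning
  a = 2 + A
  Z = suc z
  rearrange : ∀ A z → 2 + A + 2 * suc z ≡ 2 + (A + suc z + suc z)
  rearrange = solve-∀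
  distribute : ∀ a x y → a * (x + 2 * y) ≡ a * x + 2 * (a * y)
  distribute = solve-∀
  collect : ∀ a Z x → a * x + 2 * (Z * x) ≡ (a + 2 * Z) * x
  collect = solve-∀

3≤3*k : ∀ {k} → 2 ≤ k → 3 ≤ 3 * k
3≤3*k 2≤k = ℕ.*-monoʳ-≤ 3 (ℕ.≤-trans (s≤s z≤n) 2≤k)

κ-tightCycle-belowTwoK : ∀ k i → 2 ≤ k → .{{_ : NonZero (3 * k)}} → 1 ≤ i → i < 2 * k →
                         κ i (tightCycle (3 * k)) ≡ 0
κ-tightCycle-belowTwoK k i 2≤k 1≤i i<2k with m≤n⇒∃[o]m+o≡n i<2k
... | d , 1+i+d≡2k = begin
  κ i (tightCycle (3 * k)) ≡⟨ κ-tightCycle (3 * k) i (3≤3*k 2≤k) ⟩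
  cyclicCount (3 * k) i    ≡⟨ cong (λ n → cyclicCount n i) 3k≡i+Z ⟩
  cyclicCount (i + Z) i    ≡⟨ cyclicCount-vanish i Z 1≤i i<2Z ⟩
  0                        ∎
  where
  open ≡-Reasoning
  Z = k + suc d
  3k≡k+2k : ∀ k → 3 * k ≡ k + 2 * k
  3k≡k+2k = solve-∀
  swap : ∀ k i d → k + (suc i + d) ≡ i + (k + suc d)
  swap = solve-∀
  3k≡i+Z : 3 * k ≡ i + Z
  3k≡i+Z = begin
    3 * k           ≡⟨ 3k≡k+2k k ⟩
    k + 2 * k       ≡⟨ cong (k +_) 1+i+d≡2k ⟨
    k + (suc i + d) ≡⟨ swap k i d ⟩
    i + Z           ∎
  i<2Z : i < 2 * Z
  i<2Z = subst (suc i ≤_) (begin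
    suc i + (d + 2 * suc d) ≡⟨ ℕ.+-assoc (suc i) d (2 * suc d) ⟨
    suc i + d + 2 * suc d   ≡⟨ cong (_+ 2 * suc d) 1+i+d≡2k ⟩
    2 * k + 2 * suc d       ≡⟨ ℕ.*-distribˡ-+ 2 k (suc d) ⟨
    2 * Z                   ∎) (ℕ.m≤m+n (suc i) (d + 2 * suc d))

κ-tightCycle-fromTwoK : ∀ k i → 2 ≤ k → .{{_ : NonZero (3 * k)}} → i ≤ k →
  (k + 2 * i) * κ (2 * k + i) (tightCycle (3 * k)) ≡ 3 * k * ((k + 2 * i) C (3 * i))
κ-tightCycle-fromTwoK k i 2≤k i≤k with m≤n⇒∃[o]m+o≡n i≤k
... | Z , refl = begin
  a * κ W (tightCycle n)              ≡⟨ cong (a *_) (κ-tightCycle n W (3≤3*k 2≤k)) ⟩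
  a * cyclicCount n W                 ≡⟨ cong₂ (λ n W → a * cyclicCount n W) (n≡a+2Z i Z) (W≡a+Z i Z) ⟩
  a * cyclicCount (a + 2 * Z) (a + Z) ≡⟨ cyclicCount-closed a Z ⟩
  (a + 2 * Z) * (a C Z)               ≡⟨ cong₂ _*_ (n≡a+2Z i Z) aC3i≡aCZ ⟨
  n * (a C (3 * i))                   ∎
  where
  open ≡-Reasoning
  a = i + Z + 2 * i
  n = 3 * (i + Z)
  W = 2 * (i + Z) + i
  n≡a+2Z : ∀ i Z → 3 * (i + Z) ≡ i + Z + 2 * i + 2 * Z
  n≡a+2Z = solve-∀
  W≡a+Z : ∀ i Z → 2 * (i + Z) + i ≡ i + Z + 2 * i + Z
  W≡a+Z = solve-∀
  a≡3i+Z : ∀ i Z → i + Z + 2 * i ≡ 3 * i + Z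
  a≡3i+Z = solve-∀
  aC3i≡aCZ : a C (3 * i) ≡ a C Z
  aC3i≡aCZ = trans (nCk≡nC[n∸k] (subst (3 * i ≤_) (sym (a≡3i+Z i Z)) (ℕ.m≤m+n (3 * i) Z)))
                   (trans (cong (λ m → a C (m ∸ 3 * i)) (a≡3i+Z i Z)) (cong (a C_) (ℕ.m+n∸m≡n (3 * i) Z)))

lemma3p6 : (k : ℕ) → 2 ≤ k → {{nz : NonZero (3 * k)}} →
    ((i : ℕ) → 1 ≤ i → i < 2 * k → κ i (tightCycle (3 * k)) ≡ 0)
    × ((i : ℕ) → i ≤ k →
        (k + 2 * i) * κ (2 * k + i) (tightCycle (3 * k)) ≡ 3 * k * ((k + 2 * i) C (3 * i)))
lemma3p6 k 2≤k = (λ i → κ-tightCycle-belowTwoK k i 2≤k) , (λ i → κ-tightCycle-fromTwoK k i 2≤k)
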